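{- Let $m$ be an odd positive integer with $m = 2n-1$, $n \ge 2$, and write $m = 2^p(2q+1) - 1$ with $p \ge 1$, $q \ge 0$. Suppose $C(n) = 1$. Then $T^i(m-1) = 1$ for some $i$ with $1 \le i \le p+1$ if and only if $n = 2$ or $n = 3$.
   Context: $T:\mathbb{Z}^+\to\mathbb{Z}^+$ is defined by $T(x) = x/2$ if $x$ is even and $T(x) = (3x+1)/2$ if $x$ is odd; $T^k$ denotes the $k$-fold iterate. The function $C:\mathbb{Z}^+\to\{0,1\}$ is defined recursively by $C(1) = 0$, $C(n) = 1 - C(n-2)$ if $n > 1$ is odd, and $C(n) = 1 - C(n/2)$ if $n$ is even. -}

module Defs where

open import Data.Nat using (ℕ; zero; suc; _+_; _*_; _∸_; _<_; s≤s; z≤n)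
open import Data.Nat.DivMod using (_/_; _%_; m/n<m)
open import Data.Nat.Properties using (m<n+m)
open import Data.Nat.Induction using (<-rec)

T : ℕ → ℕ
T x with x % 2
... | zero  = x / 2
... | suc _ = (3 * x + 1) / 2

T^ : ℕ → ℕ → ℕ
T^ zero    x = x
T^ (suc k) x = T (T^ k x)

-- The value C 0 = 0 is a dummy
-- (C is only meaningful on positive integers; the recursion never reaches 0
-- from a positive argument).
private
  C-step : (n : ℕ) → ({m : ℕ} → m < n → ℕ) → ℕ
  C-step zero          rec = 0
  C-step (suc zero)    rec = 0
  C-step (suc (suc k)) rec with suc (suc k) % 2
  ... | zero  = 1 ∸ rec {suc (suc k) / 2} (m/n<m (suc (suc k)) 2 (s≤s (s≤s z≤n)))
  ... | suc _ = 1 ∸ rec {k} (m<n+m k (s≤s z≤n))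

C : ℕ → ℕ
C = <-rec (λ _ → ℕ) C-step

{-# OPTIONS --safe #-}
-- From m = 2n - 1 = 2ᵖa - 1 we get n = 2ᵏa with k = p - 1, and m - 1 = 2(n - 1),
-- so T^i(m - 1) = T^(i-1)(n - 1).  Since T(2b - 1) = 3b - 1 for b ≥ 1, one step
-- sends 2ᵏ⁺¹a - 1 to 2ᵏ(3a) - 1.  Inducting on k (with a replaced by 3a), the
-- orbit of 2ᵏa - 1 can reach 1 within k + 1 steps only if 2ᵏa - 1 = 1 already,
-- or if after k steps it reaches 3ᵏa - 1 = 2; so n = 2ᵏa is 2 or 3.
module Submission where

open import Defs
open import Data.Nat using (ℕ; zero; suc; _+_; _*_; _∸_; _^_; _≤_; s≤s; z≤n; NonZero; ≢-nonZero; >-nonZero⁻¹)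
open import Data.Nat.Properties
open import Data.Nat.DivMod using (_/_; m*n%n≡0; m*n/n≡m; [m+kn]%n≡m%n)
open import Data.Nat.Tactic.RingSolver using (solve-∀)
open import Data.Product using (∃; ∃-syntax; _×_; _,_)
open import Data.Sum using (_⊎_; inj₁; inj₂)
open import Function.Bundles using (_⇔_; mk⇔)
open import Relation.Binary.PropositionalEquality
open import Relation.Nullary using (contradiction)
open import Algebra.Properties.CommutativeSemigroup *-commutativeSemigroup using (x∙yz≈y∙xz)

even⊎odd : ∀ y → (∃[ c ] y ≡ 2 * c) ⊎ (∃[ c ] y ≡ 1 + 2 * c)
even⊎odd zero = inj₁ (0 , refl)
even⊎odd (suc y) with even⊎odd y
... | inj₁ (c , refl) = inj₂ (c , refl)
... | inj₂ (c , refl) = inj₁ (suc c , sym (*-suc 2 c))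

∸1≡⇒≡suc : ∀ x {y} .{{_ : NonZero x}} → x ∸ 1 ≡ y → x ≡ suc y
∸1≡⇒≡suc (suc x) refl = refl

3*b≢2 : ∀ b → 3 * b ≢ 2
3*b≢2 (suc b) eq with trans (sym (*-suc 3 b)) eq
... | ()

T-double : ∀ c → T (2 * c) ≡ c
T-double c rewrite *-comm 2 c | m*n%n≡0 c 2 {{_}} = m*n/n≡m c 2

T-odd : ∀ c → T (1 + 2 * c) ≡ 2 + 3 * c
T-odd c = begin
  T (1 + 2 * c)              ≡⟨ cong (λ x → T (1 + x)) (*-comm 2 c) ⟩
  T (1 + c * 2)              ≡⟨ T-unfold ⟩
  (3 * (1 + c * 2) + 1) / 2  ≡⟨ cong (_/ 2) (identity c) ⟩
  (2 + 3 * c) * 2 / 2        ≡⟨ m*n/n≡m (2 + 3 * c) 2 ⟩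
  2 + 3 * c                  ∎
  where
  open ≡-Reasoning
  T-unfold : T (1 + c * 2) ≡ (3 * (1 + c * 2) + 1) / 2
  T-unfold rewrite [m+kn]%n≡m%n 1 c 2 {{_}} = refl
  identity : ∀ c → 3 * (1 + c * 2) + 1 ≡ (2 + 3 * c) * 2
  identity = solve-∀

T-pred-double : ∀ b .{{_ : NonZero b}} → T (2 * b ∸ 1) ≡ 3 * b ∸ 1
T-pred-double (suc c) = begin
  T (2 * suc c ∸ 1)  ≡⟨ cong (λ x → T (x ∸ 1)) (*-suc 2 c) ⟩
  T (1 + 2 * c)      ≡⟨ T-odd c ⟩
  2 + 3 * c          ≡⟨ cong (_∸ 1) (*-suc 3 c) ⟨
  3 * suc c ∸ 1      ∎
  where open ≡-Reasoning

T≡1⇒≡2 : ∀ y → T y ≡ 1 → y ≡ 2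
T≡1⇒≡2 y Ty≡1 with even⊎odd y
... | inj₁ (c , refl) = cong (2 *_) (trans (sym (T-double c)) Ty≡1)
... | inj₂ (c , refl) with trans (sym (T-odd c)) Ty≡1
...   | ()

T^-suc : ∀ j x → T^ (suc j) x ≡ T^ j (T x)
T^-suc zero    x = refl
T^-suc (suc j) x = cong T (T^-suc j x)

T^-double : ∀ j x → T^ (suc j) (2 * x) ≡ T^ j x
T^-double j x = trans (T^-suc j (2 * x)) (cong (T^ j) (T-double x))

T-pred-2^suc : ∀ k a .{{_ : NonZero a}} →
               T (2 ^ suc k * a ∸ 1) ≡ 2 ^ k * (3 * a) ∸ 1
T-pred-2^suc k a = begin
  T (2 * 2 ^ k * a ∸ 1)    ≡⟨ cong (λ x → T (x ∸ 1)) (*-assoc 2 (2 ^ k) a) ⟩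
  T (2 * (2 ^ k * a) ∸ 1)  ≡⟨ T-pred-double (2 ^ k * a) {{m*n≢0 (2 ^ k) a {{m^n≢0 2 k}}}} ⟩
  3 * (2 ^ k * a) ∸ 1      ≡⟨ cong (_∸ 1) (x∙yz≈y∙xz 3 (2 ^ k) a) ⟩
  2 ^ k * (3 * a) ∸ 1      ∎
  where open ≡-Reasoning

T^[2^k*a∸1]≡1⇒2^k*a≡2⊎3 : ∀ j k a .{{_ : NonZero a}} → j ≤ suc k →
                           T^ j (2 ^ k * a ∸ 1) ≡ 1 →
                           2 ^ k * a ≡ 2 ⊎ 2 ^ k * a ≡ 3
T^[2^k*a∸1]≡1⇒2^k*a≡2⊎3 zero k a _ eq =
  inj₁ (∸1≡⇒≡suc (2 ^ k * a) {{m*n≢0 (2 ^ k) a {{m^n≢0 2 k}}}} eq)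
T^[2^k*a∸1]≡1⇒2^k*a≡2⊎3 (suc zero) zero a _ eq =
  inj₂ (∸1≡⇒≡suc (1 * a) {{m*n≢0 1 a}} (T≡1⇒≡2 _ eq))
T^[2^k*a∸1]≡1⇒2^k*a≡2⊎3 (suc (suc j)) zero a (s≤s ())
T^[2^k*a∸1]≡1⇒2^k*a≡2⊎3 (suc j) (suc k) a (s≤s j≤1+k) eq
  with T^[2^k*a∸1]≡1⇒2^k*a≡2⊎3 j k (3 * a) {{m*n≢0 3 a}} j≤1+k
         (trans (sym (cong (T^ j) (T-pred-2^suc k a))) (trans (sym (T^-suc j _)) eq))
... | inj₁ 2^k*3a≡2 = contradiction (trans (x∙yz≈y∙xz 3 (2 ^ k) a) 2^k*3a≡2) (3*b≢2 (2 ^ k * a))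
... | inj₂ 2^k*3a≡3 = inj₁ (trans (*-assoc 2 (2 ^ k) a) (cong (2 *_) 2^k*a≡1))
  where
  2^k*a≡1 : 2 ^ k * a ≡ 1
  2^k*a≡1 = *-cancelˡ-≡ (2 ^ k * a) 1 3 (trans (x∙yz≈y∙xz 3 (2 ^ k) a) 2^k*3a≡3)

2*n∸1∸1≡2*[n∸1] : ∀ n → 2 * n ∸ 1 ∸ 1 ≡ 2 * (n ∸ 1)
2*n∸1∸1≡2*[n∸1] n = trans (∸-+-assoc (2 * n) 1 1) (sym (*-distribˡ-∸ 2 n 1))

lemma4p2 : (m n p q : ℕ) → m ≡ 2 * n ∸ 1 → 2 ≤ n →
    m ≡ 2 ^ p * (2 * q + 1) ∸ 1 → 1 ≤ p → C n ≡ 1 →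
    ((∃ λ i → 1 ≤ i × i ≤ p + 1 × T^ i (m ∸ 1) ≡ 1) ⇔ (n ≡ 2 ⊎ n ≡ 3))
lemma4p2 m n@(suc _) (suc k) q refl (s≤s _) m≡2^p*a∸1 (s≤s z≤n) _ = mk⇔ to from
  where
  a = 2 * q + 1
  instance
    a≢0 : NonZero a
    a≢0 = ≢-nonZero (m+1+n≢0 (2 * q))

  n≡2^k*a : n ≡ 2 ^ k * a
  n≡2^k*a = *-cancelˡ-≡ n (2 ^ k * a) 2 (trans
    (∸-cancelʳ-≡ (s≤s z≤n) (>-nonZero⁻¹ _ {{m*n≢0 (2 ^ suc k) a {{m^n≢0 2 (suc k)}}}}) m≡2^p*a∸1)
    (*-assoc 2 (2 ^ k) a))

  to : (∃ λ i → 1 ≤ i × i ≤ suc k + 1 × T^ i (m ∸ 1) ≡ 1) → n ≡ 2 ⊎ n ≡ 3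
  to (suc j , _ , s≤s j≤k+1 , T^i[m∸1]≡1) = subst (λ x → x ≡ 2 ⊎ x ≡ 3) (sym n≡2^k*a)
    (T^[2^k*a∸1]≡1⇒2^k*a≡2⊎3 j k a (subst (j ≤_) (+-comm k 1) j≤k+1)
      (subst (λ x → T^ j (x ∸ 1) ≡ 1) n≡2^k*a T^j[n∸1]≡1))
    where
    T^j[n∸1]≡1 : T^ j (n ∸ 1) ≡ 1
    T^j[n∸1]≡1 = begin
      T^ j (n ∸ 1)              ≡⟨ T^-double j (n ∸ 1) ⟨
      T^ (suc j) (2 * (n ∸ 1))  ≡⟨ cong (T^ (suc j)) (2*n∸1∸1≡2*[n∸1] n) ⟨
      T^ (suc j) (m ∸ 1)        ≡⟨ T^i[m∸1]≡1 ⟩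
      1                         ∎
      where open ≡-Reasoning

  from : n ≡ 2 ⊎ n ≡ 3 → ∃ λ i → 1 ≤ i × i ≤ suc k + 1 × T^ i (m ∸ 1) ≡ 1
  from (inj₁ refl) = 1 , s≤s z≤n , s≤s z≤n , refl
  from (inj₂ refl) = 2 , s≤s z≤n , s≤s (m≤n+m 1 k) , refl
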